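{- Let $\pi$ be a deterministic broadcast protocol (in the radio network model described in the context) whose number of rounds $r(n)$ on networks with parameter $n$ satisfies $r(n) = o(\sqrt{n})$. Then (for all sufficiently large $n$) there exists a $C_2$ network $N$ such that $\pi$ does not complete broadcast within $r(n)$ rounds when executed on $N$. In other words, every deterministic broadcast protocol needs $\Omega(\sqrt{n})$ rounds on some $C_2$ network (a network of radius $2$).
   Context: Radio network model: the network is an undirected connected graph whose vertices (nodes) are processors with distinct labels from $\{0,1,\dots,m\}$, $m$ polynomial in the number of nodes; the node with label $0$ is the source, which holds a broadcast message. Computation proceeds in synchronous rounds $0,1,2,\dots$; all nodes run identical copies of the same deterministic protocol. In each round each node either transmits, receives, or is inactive. A node receives a message in a round if and only if it acts as a receiver and exactly one of its neighbours transmits in that round; otherwise it receives $\phi$ (no distinction between silence and collision). Messages are authenticated (the receiver learns the label of the sender). The action of a node in a round is determined by its initial input (its own label and the labels of its neighbours) and the messages it received in previous rounds. In round $0$ only the source transmits (the broadcast message). Only nodes that have already received a message may transmit (the only spontaneous transmission is the source's in round $0$). Broadcast is completed in $r$ rounds if every node receives the source message in one of the rounds $0,1,\dots,r-1$. $C_2$ networks (for $n$ a perfect square): the nodes are partitioned into layers $L_0,L_1,L_2$. $L_0$ consists only of the source. $L_1$ consists of $\sqrt{n}$ groups of $\sqrt{n}$ nodes each, all connected to the source. $L_2$ consists of $\sqrt{n}$ nodes, each associated with a distinct group of $L_1$ and connected to an arbitrary subset of the nodes of that group (no other edges). A group of $L_1$ together with its associated $L_2$ node is a (BGI-)component. The node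 labels are fixed and the same for all $C_2$ networks, so $C_2$ networks differ only in the edge sets between the $L_2$ nodes and their groups. -}

module Defs where

open import Data.Nat using (ℕ; zero; suc; _+_; _*_; _^_; _≤_)
open import Data.Fin using (Fin)
open import Data.Bool using (Bool; true; false; if_then_else_; not)
open import Data.Maybe using (Maybe; just; nothing; is-just)
import Data.Maybe as Maybe
open import Data.List using (List; []; _∷_; map; concatMap; filterᵇ; allFin; mapMaybe)
open import Data.Bool.ListAction using (any)
open import Data.Product using (_×_; _,_; ∃)
open import Relation.Binary.PropositionalEquality using (_≡_)
open import Relation.Nullary using (¬_)

-- C₂ networks with parameter n = k * k  (k = √n)

data Node (k : ℕ) : Set where
  src : Node k
  l1  : (g i : Fin k) → Node k
  l2  : (g : Fin k) → Node k

isSrc : ∀ {k} → Node k → Bool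
isSrc src      = true
isSrc (l1 _ _) = false
isSrc (l2 _)   = false

-- A C₂ network is given by the edges between L₂ nodes and their groups:
-- E g i ≡ true  iff  l2 g is adjacent to l1 g i.  (All other edges are fixed.)
C2Edges : ℕ → Set
C2Edges k = Fin k → Fin k → Bool

-- The network must be a connected graph: every L₂ node has a neighbour.
Connected : ∀ {k} → C2Edges k → Set
Connected {k} E = ∀ (g : Fin k) → ∃ λ (i : Fin k) → E g i ≡ true

neighbours : ∀ {k} → C2Edges k → Node k → List (Node k)
neighbours {k} E src      = concatMap (λ g → map (l1 g) (allFin k)) (allFin k)
neighbours {k} E (l1 g i) = src ∷ (if E g i then l2 g ∷ [] else [])
neighbours {k} E (l2 g)   = map (l1 g) (filterᵇ (E g) (allFin k))

Labelling : Set
Labelling = (k : ℕ) → Node k → ℕ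

ValidLabelling : Labelling → Set
ValidLabelling lab =
  (∀ k → lab k src ≡ 0) ×
  (∀ k (u v : Node k) → lab k u ≡ lab k v → u ≡ v) ×
  (∃ λ c → ∀ k (v : Node k) → lab k v ≤ (1 + k * k + k) ^ c)

data Action (M : Set) : Set where
  transmit : M → Action M
  receive  : Action M
  inactive : Action M

-- History of a node: what it received in each past round, most recent first;
-- nothing = φ, just (ℓ , m) = message m from the neighbour with label ℓ.
Hist : Set → Set
Hist M = List (Maybe (ℕ × M))

-- The action is determined by own label, list of neighbour labels, history.
Protocol : Set → Set
Protocol M = ℕ → List ℕ → Hist M → Action M

isReceive : ∀ {M} → Action M → Bool
isReceive receive = true
isReceive _       = false

transmitted : ∀ {M} → Action M → Maybe M
transmitted (transmit m) = just m
transmitted _            = nothing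

module Execution {M : Set} (m₀ : M) (π : Protocol M) {k : ℕ}
                 (lab : Node k → ℕ) (E : C2Edges k) where

  informed : Node k → Hist M → Bool
  informed v h = if isSrc v then true else any is-just h

  act : (Node k → Hist M) → Node k → Action M
  act h v = π (lab v) (map lab (neighbours E v)) (h v)

  exactlyOne : {A : Set} → List A → Maybe A
  exactlyOne (x ∷ []) = just x
  exactlyOne _        = nothing

  reception : (Node k → Maybe M) → Bool → Node k → Maybe (ℕ × M)
  reception tx listens v =
    if listens
    then exactlyOne (mapMaybe (λ u → Maybe.map (λ m → (lab u , m)) (tx u)) (neighbours E v))
    else nothing

  -- round 0: only the source transmits (m₀), every other node listens
  -- round t ≥ 1: informed nodes act according to π; uninformed nodes cannot transmit
  recvAt : ℕ → (Node k → Hist M) → Node k → Maybe (ℕ × M)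
  recvAt zero    h v = reception (λ u → if isSrc u then just m₀ else nothing) (not (isSrc v)) v
  recvAt (suc t) h v =
    reception (λ u → if informed u (h u) then transmitted (act h u) else nothing)
              (isReceive (act h v)) v

  -- state t v = history of v after rounds 0 .. t-1
  state : ℕ → Node k → Hist M
  state zero    v = []
  state (suc t) v = recvAt t (state t) v ∷ state t v

  Completes : ℕ → Set
  Completes r = ∀ (v : Node k) → isSrc v ≡ false → any is-just (state r v) ≡ true

Completes : ∀ {M : Set} → M → Protocol M → ∀ {k} → (Node k → ℕ) → C2Edges k → ℕ → Set
Completes m₀ π lab E r = Execution.Completes m₀ π lab E r

-- r(n) = o(√n):  for every c, eventually c · r(n) ≤ √n, i.e. (c·r(n))² ≤ n
LittleOSqrt : (ℕ → ℕ) → Set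
LittleOSqrt r = ∀ (c : ℕ) → ∃ λ N₀ → ∀ n → N₀ ≤ n → (c * r n) * (c * r n) ≤ n

module Submission where

-- Adversary argument on the k = √n groups.  Each group is either *settled*
-- (the neighbourhood of its L2 node is fixed) or *live*: its candidate rows
-- form a GF(2)-subspace given by an echelon basis and parity constraints.
-- The invariant `Good t` says that all networks of the current family look
-- alike to the source, to L1 nodes with equal edge bit and to settled L2
-- nodes, while live L2 nodes have heard nothing.  So in round t every L1 node
-- transmits as a function of its own edge bit, and the adversary answers with
-- a parity cut (a live L2 node hears nothing when an even number of its
-- neighbours transmit) and two forcing steps (the source hears a collision
-- or the same thing everywhere), costing ≤ 3 dimensions and ≤ 2 settled
-- groups per round.  If 3r + 1 ≤ k, after r rounds some group is still live
-- and uninformed, and every group still has a nonzero row (`fooled`).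

open import Defs
open import Data.Nat using (ℕ; zero; suc; _+_; _*_; _≤_; _<_; z≤n; s≤s; _≤?_)
open import Data.Nat.Properties hiding (_≟_)
open import Data.Fin using (Fin; zero; suc; _≟_)
open import Data.Bool using (Bool; true; false; if_then_else_; not; _∧_; _∨_; _xor_)
open import Data.Bool.Properties
  using (∧-distribʳ-xor; xor-∧-commutativeRing; ∧-conicalˡ; ∧-conicalʳ; ∨-conicalˡ; ∨-conicalʳ)
open import Data.Maybe using (Maybe; just; nothing; is-just; _<∣>_)
import Data.Maybe as Maybe
open import Data.List using (List; []; _∷_; map; concatMap; filterᵇ; allFin; mapMaybe; catMaybes; length; replicate)
open import Data.List.Properties using (mapMaybe-cong; map-∘)
open import Data.List.Relation.Unary.All using (All; []; _∷_)
open import Data.List.Relation.Unary.Any using (Any; here; there)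
open import Data.List.Membership.Propositional.Properties using (∈-concatMap⁺; ∈-map⁺; ∈-allFin)
open import Data.Bool.ListAction using (any)
open import Data.Nat.Solver using (module +-*-Solver)
open import Data.Vec.Functional using (updateAt)
open import Data.Vec.Functional.Properties using (updateAt-updates; updateAt-minimal)
open import Data.Product using (_×_; _,_; ∃; proj₁; proj₂)
open import Data.Sum using (_⊎_; inj₁; inj₂)
open import Data.Empty using (⊥-elim)
open import Data.Unit using (⊤; tt)
open import Function using (_∘_; const)
open import Relation.Nullary using (¬_; Dec; yes; no; does)
open import Relation.Nullary.Decidable using (dec-true; dec-false)
open import Relation.Binary.PropositionalEquality
open import Algebra.Bundles using (CommutativeRing)
open import Algebra.Properties.CommutativeSemigroup
  (CommutativeRing.+-commutativeSemigroup xor-∧-commutativeRing) using (interchange)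

private variable
  A B : Set

firstJust : ∀ {n} → (Fin n → Maybe A) → Maybe A
firstJust {n = zero}  f = nothing
firstJust {n = suc n} f = f zero <∣> firstJust (f ∘ suc)

firstJust-sound : ∀ {n} (f : Fin n → Maybe A) {a} → firstJust f ≡ just a → ∃ λ q → f q ≡ just a
firstJust-sound {n = suc n} f eq with f zero in e
... | just _  = zero , trans e eq
... | nothing with firstJust-sound (f ∘ suc) eq
...   | q , p = suc q , p

firstJust-nothing : ∀ {n} (f : Fin n → Maybe A) → firstJust f ≡ nothing → ∀ q → f q ≡ nothing
firstJust-nothing {n = suc n} f eq q with f zero in e
firstJust-nothing {n = suc n} f eq zero    | nothing = e
firstJust-nothing {n = suc n} f eq (suc q) | nothing = firstJust-nothing (f ∘ suc) eq q

bit : Bool → ℕ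
bit true  = 1
bit false = 0

count : ∀ {n} → (Fin n → Bool) → ℕ
count {zero}  f = 0
count {suc n} f = bit (f zero) + count (f ∘ suc)

bit-mono : ∀ {a b} → (a ≡ true → b ≡ true) → bit a ≤ bit b
bit-mono {false} _ = z≤n
bit-mono {true}  h rewrite h refl = ≤-refl

bit≤1 : ∀ a → bit a ≤ 1
bit≤1 true  = ≤-refl
bit≤1 false = z≤n

count-mono : ∀ {n} (f g : Fin n → Bool) → (∀ q → f q ≡ true → g q ≡ true) → count f ≤ count g
count-mono {zero}  f g h = z≤n
count-mono {suc n} f g h = +-mono-≤ (bit-mono (h zero)) (count-mono _ _ (h ∘ suc))

count-cong : ∀ {n} (f g : Fin n → Bool) → (∀ q → f q ≡ g q) → count f ≡ count g
count-cong {zero}  f g h = refl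
count-cong {suc n} f g h = cong₂ _+_ (cong bit (h zero)) (count-cong _ _ (h ∘ suc))

count-except : ∀ {n} (f g : Fin n → Bool) (q* : Fin n) →
  (∀ q → f q ≡ true → g q ≡ true ⊎ q ≡ q*) → count f ≤ suc (count g)
count-except {suc n} f g zero h =
  +-mono-≤ (bit≤1 (f zero)) (≤-trans (count-mono _ _ tail) (m≤n+m _ (bit (g zero))))
  where
  tail : ∀ q → f (suc q) ≡ true → g (suc q) ≡ true
  tail q e with h (suc q) e
  ... | inj₁ x = x
count-except {suc n} f g (suc q*) h = begin
    bit (f zero) + count (f ∘ suc)
  ≤⟨ +-mono-≤ (bit-mono head) (count-except _ _ q* tail) ⟩
    bit (g zero) + suc (count (g ∘ suc))
  ≡⟨ +-suc (bit (g zero)) _ ⟩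
    suc (count g)
  ∎
  where
  open ≤-Reasoning
  head : f zero ≡ true → g zero ≡ true
  head e with h zero e
  ... | inj₁ x = x
  tail : ∀ q → f (suc q) ≡ true → g (suc q) ≡ true ⊎ q ≡ q*
  tail q e with h (suc q) e
  ... | inj₁ x    = inj₁ x
  ... | inj₂ refl = inj₂ refl

count-pos : ∀ {n} (f : Fin n → Bool) → 0 < count f → ∃ λ q → f q ≡ true
count-pos {suc n} f p with f zero in e
... | true  = zero , e
... | false with count-pos (f ∘ suc) p
...   | q , x = suc q , x

count-<n : ∀ {n} (f : Fin n → Bool) → count f < n → ∃ λ q → f q ≡ false
count-<n {suc n} f p with f zero in e
... | false = zero , e
... | true with count-<n (f ∘ suc) (≤-pred p)
...   | q , x = suc q , x

count-true : ∀ n → count {n} (const true) ≡ n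
count-true zero    = refl
count-true (suc n) = cong suc (count-true n)

count-false : ∀ n → count {n} (const false) ≡ 0
count-false zero    = refl
count-false (suc n) = count-false n

filter-cong : ∀ (p q : A → Bool) → (∀ x → p x ≡ q x) → ∀ xs → filterᵇ p xs ≡ filterᵇ q xs
filter-cong p q h [] = refl
filter-cong p q h (x ∷ xs) with p x | q x | h x
... | true  | true  | _ = cong (x ∷_) (filter-cong p q h xs)
... | false | false | _ = filter-cong p q h xs

filter≤mapMaybe : ∀ (P : A → Bool) (f : A → Maybe B) → (∀ x → P x ≡ true → is-just (f x) ≡ true) →
  ∀ xs → length (filterᵇ P xs) ≤ length (mapMaybe f xs)
filter≤mapMaybe P f h [] = z≤n
filter≤mapMaybe P f h (x ∷ xs) with P x | f x | h x
... | false | nothing | _ = filter≤mapMaybe P f h xs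
... | false | just _  | _ = m≤n⇒m≤1+n (filter≤mapMaybe P f h xs)
... | true  | just _  | _ = s≤s (filter≤mapMaybe P f h xs)
... | true  | nothing | h′ with h′ refl
...   | ()

filter-mono : ∀ (P Q : A → Bool) → (∀ x → P x ≡ true → Q x ≡ true) →
  ∀ xs → length (filterᵇ P xs) ≤ length (filterᵇ Q xs)
filter-mono P Q h [] = z≤n
filter-mono P Q h (x ∷ xs) with P x | Q x | h x
... | false | false | _ = filter-mono P Q h xs
... | false | true  | _ = m≤n⇒m≤1+n (filter-mono P Q h xs)
... | true  | true  | _ = s≤s (filter-mono P Q h xs)
... | true  | false | h′ with h′ refl
...   | ()

filter-mono-< : ∀ (P Q : A → Bool) → (∀ x → P x ≡ true → Q x ≡ true) → ∀ {w} xs → Any (w ≡_) xs →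
  Q w ≡ true → P w ≡ false → length (filterᵇ P xs) < length (filterᵇ Q xs)
filter-mono-< P Q h (x ∷ xs) (here refl) qw pw rewrite qw | pw = s≤s (filter-mono P Q h xs)
filter-mono-< P Q h (x ∷ xs) (there w∈) qw pw with P x | Q x | h x
... | false | false | _ = filter-mono-< P Q h xs w∈ qw pw
... | false | true  | _ = m≤n⇒m≤1+n (filter-mono-< P Q h xs w∈ qw pw)
... | true  | true  | _ = s≤s (filter-mono-< P Q h xs w∈ qw pw)
... | true  | false | h′ with h′ refl
...   | ()

odd : ℕ → Bool
odd zero    = false
odd (suc n) = not (odd n)

mapMaybe-map : ∀ {C : Set} (f : B → Maybe C) (h : A → B) xs → mapMaybe f (map h xs) ≡ mapMaybe (f ∘ h) xs
mapMaybe-map f h xs = cong catMaybes (sym (map-∘ xs))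

is-just-map : ∀ (f : A → B) (m : Maybe A) → is-just (Maybe.map f m) ≡ is-just m
is-just-map f (just _) = refl
is-just-map f nothing  = refl

-- A network-independent copy of `exactlyOne`: the unique element of a singleton list.
theOnly : List A → Maybe A
theOnly (x ∷ []) = just x
theOnly _        = nothing

theOnly-≥2 : ∀ (xs : List A) → 2 ≤ length xs → theOnly xs ≡ nothing
theOnly-≥2 (x ∷ y ∷ xs) _ = refl
theOnly-≥2 (x ∷ []) (s≤s ())

theOnly-even : ∀ (xs : List A) → odd (length xs) ≡ false → theOnly xs ≡ nothing
theOnly-even []           _ = refl
theOnly-even (x ∷ y ∷ xs) _ = refl

updateAt-lift : ∀ {n} (P : Fin n → A → Set) (xs : Fin n → A) (i : Fin n) (f : A → A) →
  P i (f (xs i)) → (∀ j → ¬ j ≡ i → P j (xs j)) → ∀ j → P j (updateAt xs i f j)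
updateAt-lift P xs i f at-i elsewhere j with j ≟ i
... | yes refl = subst (P i) (sym (updateAt-updates i xs)) at-i
... | no j≢i   = subst (P j) (sym (updateAt-minimal j i xs j≢i)) (elsewhere j j≢i)

-- Linear algebra over GF(2) = Bool, in dimension k.
module GF2 (k : ℕ) where

  -- A row is a vector of GF(2)^k: a candidate neighbourhood of an L2 node inside its group.
  Row : Set
  Row = Fin k → Bool

  _⊕_ : Row → Row → Row
  (a ⊕ b) j = a j xor b j

  zeroRow : Row
  zeroRow _ = false

  Linear : (Row → Bool) → Set
  Linear f = ∀ a b → f (a ⊕ b) ≡ f a xor f b

  coordinate-linear : ∀ i → Linear (λ s → s i)
  coordinate-linear i a b = refl

  parityOn : Row → List (Fin k) → Row → Bool
  parityOn c []       s = false
  parityOn c (i ∷ is) s = (s i ∧ c i) xor parityOn c is s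

  parity : Row → Row → Bool
  parity c s = parityOn c (allFin k) s

  private
    ∧-xor-medial : ∀ x y c a b → ((x xor y) ∧ c) xor (a xor b) ≡ ((x ∧ c) xor a) xor ((y ∧ c) xor b)
    ∧-xor-medial x y c a b =
      trans (cong (_xor (a xor b)) (∧-distribʳ-xor c x y)) (interchange (x ∧ c) (y ∧ c) a b)

  parityOn-linear : ∀ c is → Linear (parityOn c is)
  parityOn-linear c []       a b = refl
  parityOn-linear c (i ∷ is) a b
    rewrite parityOn-linear c is a b = ∧-xor-medial (a i) (b i) (c i) _ _

  parity-linear : ∀ c → Linear (parity c)
  parity-linear c = parityOn-linear c (allFin k)

  parityOn-ext : ∀ c is a b → (∀ j → a j ≡ b j) → parityOn c is a ≡ parityOn c is b
  parityOn-ext c []       a b h = refl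
  parityOn-ext c (i ∷ is) a b h rewrite h i | parityOn-ext c is a b h = refl

  parityOn-zero : ∀ c is → parityOn c is zeroRow ≡ false
  parityOn-zero c []       = refl
  parityOn-zero c (i ∷ is) = parityOn-zero c is

  Satisfies : List Row → Row → Set
  Satisfies cs s = All (λ c → parity c s ≡ false) cs

  satisfies-zero : ∀ cs → Satisfies cs zeroRow
  satisfies-zero []       = []
  satisfies-zero (c ∷ cs) = parityOn-zero c (allFin k) ∷ satisfies-zero cs

  satisfies-ext : ∀ cs a b → (∀ j → a j ≡ b j) → Satisfies cs b → Satisfies cs a
  satisfies-ext []       a b h []       = []
  satisfies-ext (c ∷ cs) a b h (x ∷ xs) =
    trans (parityOn-ext c (allFin k) a b h) x ∷ satisfies-ext cs a b h xs

  odd-successes : ∀ (f : Fin k → Maybe A) (s c : Row) → (∀ j → s j ≡ true → is-just (f j) ≡ c j) →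
    ∀ is → odd (length (mapMaybe f (filterᵇ s is))) ≡ parityOn c is s
  odd-successes f s c h [] = refl
  odd-successes f s c h (j ∷ is) with s j in sj
  ... | false = odd-successes f s c h is
  ... | true with f j | h j sj
  ...   | just _  | e rewrite sym e | odd-successes f s c h is = refl
  ...   | nothing | e rewrite sym e | odd-successes f s c h is = refl

  -- A partial echelon basis: slot q is empty or holds a basis vector with pivot q.
  Basis : Set
  Basis = Fin k → Maybe Row

  record Echelon (B : Basis) (cs : List Row) : Set where
    field
      satisfies  : ∀ q b → B q ≡ just b → Satisfies cs b
      pivot-one  : ∀ q b → B q ≡ just b → b q ≡ true
      pivot-zero : ∀ q q′ b → B q ≡ just b → is-just (B q′) ≡ true → ¬ q′ ≡ q → b q′ ≡ false
  open Echelon public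

  VanishesAt : Basis → Fin k → Set
  VanishesAt B j = ∀ q b → B q ≡ just b → b j ≡ false

  -- The rows a live group may still take: those satisfying the constraints
  -- and vanishing on every coordinate where the whole basis vanishes.
  Admissible : Basis → List Row → Row → Set
  Admissible B cs s = Satisfies cs s × (∀ j → VanishesAt B j → s j ≡ false)

  rank : Basis → ℕ
  rank B = count (is-just ∘ B)

  pivotFor : Basis → Fin k → Maybe Row
  pivotFor B i = firstJust λ q → Maybe.maybe (λ b → if b i then just b else nothing) nothing (B q)

  pivotFor-just : ∀ B i {b} → pivotFor B i ≡ just b → ∃ λ q → B q ≡ just b × b i ≡ true
  pivotFor-just B i eq with firstJust-sound _ eq
  ... | q , e with B q in Bq
  ...   | just b with b i in bi
  pivotFor-just B i eq | q , refl | just b | true = q , Bq , bi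

  pivotFor-nothing : ∀ B i → pivotFor B i ≡ nothing → VanishesAt B i
  pivotFor-nothing B i eq q b Bq with firstJust-nothing _ eq q
  ... | e rewrite Bq with b i
  ...   | false = refl

  vanishes⇒pivotFor-nothing : ∀ B i → VanishesAt B i → pivotFor B i ≡ nothing
  vanishes⇒pivotFor-nothing B i z with pivotFor B i in e
  ... | nothing = refl
  ... | just b with pivotFor-just B i e
  ...   | q , Bq , bi with trans (sym bi) (z q b Bq)
  ...     | ()

  -- One step of Gaussian elimination cutting the span down to the kernel of f:
  -- take the first basis vector b* with f b* = 1, drop its slot, and add b*
  -- to every other basis vector on which f is 1.
  hitting : (Row → Bool) → Basis → Fin k → Maybe (Fin k × Row)
  hitting f B q = Maybe.maybe (λ b → if f b then just (q , b) else nothing) nothing (B q)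

  reduceBy : (Row → Bool) → Maybe (Fin k × Row) → Basis → Basis
  reduceBy f nothing          B   = B
  reduceBy f (just (q* , b*)) B q with q ≟ q*
  ... | yes _ = nothing
  ... | no  _ = Maybe.map (λ b → if f b then b ⊕ b* else b) (B q)

  cut : (Row → Bool) → Basis → Basis
  cut f B = reduceBy f (firstJust (hitting f B)) B

  data Origin (f : Row → Bool) (B : Basis) (q : Fin k) (b′ : Row) : Set where
    kept    : ∀ b → B q ≡ just b → f b ≡ false → b′ ≡ b → Origin f B q b′
    reduced : ∀ b q* b* → B q ≡ just b → B q* ≡ just b* → ¬ q ≡ q* → f b* ≡ true → f b ≡ true →
              b′ ≡ b ⊕ b* → firstJust (hitting f B) ≡ just (q* , b*) → Origin f B q b′

  hitting-nothing : ∀ f B q b → firstJust (hitting f B) ≡ nothing → B q ≡ just b → f b ≡ false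
  hitting-nothing f B q b eq Bq with firstJust-nothing (hitting f B) eq q
  ... | e rewrite Bq with f b
  ...   | false = refl

  hitting-just : ∀ f B {q* b*} → firstJust (hitting f B) ≡ just (q* , b*) → B q* ≡ just b* × f b* ≡ true
  hitting-just f B eq with firstJust-sound (hitting f B) eq
  ... | q , e with B q in Bq
  ...   | just b with f b in fb
  hitting-just f B eq | q , refl | just b | true = Bq , fb

  origin : ∀ f B q b′ → cut f B q ≡ just b′ → Origin f B q b′
  origin f B q b′ eq with firstJust (hitting f B) in fe
  ... | nothing = kept b′ eq (hitting-nothing f B q b′ fe eq) refl
  ... | just (q* , b*) with q ≟ q*
  ...   | no q≢q* with B q in Bq
  ...     | just b with f b in fb | eq
  ...       | true  | refl = reduced b q* b* Bq (proj₁ (hitting-just f B fe)) q≢q*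
                               (proj₂ (hitting-just f B fe)) fb refl fe
  ...       | false | refl = kept b Bq fb refl

  cut-emptied : ∀ {f} B {q* b*} → firstJust (hitting f B) ≡ just (q* , b*) → cut f B q* ≡ nothing
  cut-emptied B {q*} fe rewrite fe with q* ≟ q*
  ... | yes _    = refl
  ... | no q*≢q* = ⊥-elim (q*≢q* refl)

  cut-occupied : ∀ f B q → is-just (cut f B q) ≡ true → is-just (B q) ≡ true
  cut-occupied f B q e with cut f B q in eq
  ... | just b′ with origin f B q b′ eq
  ...   | kept _ Bq _ _              rewrite Bq = refl
  ...   | reduced _ _ _ Bq _ _ _ _ _ _ rewrite Bq = refl

  rank-cut : ∀ f B → rank B ≤ suc (rank (cut f B))
  rank-cut f B with firstJust (hitting f B) in fe
  ... | nothing        = n≤1+n _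
  ... | just (q* , b*) = count-except _ _ q* still-occupied
    where
    still-occupied : ∀ q → is-just (B q) ≡ true →
                     is-just (reduceBy f (just (q* , b*)) B q) ≡ true ⊎ q ≡ q*
    still-occupied q e with q ≟ q*
    ... | yes q≡q* = inj₂ q≡q*
    ... | no _ with B q
    ...   | just _ = inj₁ refl

  cut-vanishes : ∀ f B j → VanishesAt B j → VanishesAt (cut f B) j
  cut-vanishes f B j z q b′ eq with origin f B q b′ eq
  ... | kept b Bq _ refl = z q b Bq
  ... | reduced b q* b* Bq Bq* _ _ _ refl _ rewrite z q b Bq | z q* b* Bq* = refl

  module _ (f : Row → Bool) (f-linear : Linear f) where

    cut-kernel : ∀ B q b′ → cut f B q ≡ just b′ → f b′ ≡ false
    cut-kernel B q b′ eq with origin f B q b′ eq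
    ... | kept b _ fb refl = fb
    ... | reduced b q* b* _ _ _ fb* fb refl _ rewrite f-linear b b* | fb* | fb = refl

    cut-preserves : ∀ (g : Row → Bool) → Linear g → ∀ B → (∀ q b → B q ≡ just b → g b ≡ false) →
                    ∀ q b′ → cut f B q ≡ just b′ → g b′ ≡ false
    cut-preserves g g-linear B h q b′ eq with origin f B q b′ eq
    ... | kept b Bb _ refl = h q b Bb
    ... | reduced b q* b* Bb Bb* _ _ _ refl _ rewrite g-linear b b* | h q b Bb | h q* b* Bb* = refl

    cut-satisfies : ∀ B cs → (∀ q b → B q ≡ just b → Satisfies cs b) →
                    ∀ q b′ → cut f B q ≡ just b′ → Satisfies cs b′
    cut-satisfies B []       h q b′ eq = []
    cut-satisfies B (c ∷ cs) h q b′ eq =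
      cut-preserves (parity c) (parity-linear c) B (λ q b Bb → head (h q b Bb)) q b′ eq
      ∷ cut-satisfies B cs (λ q b Bb → tail (h q b Bb)) q b′ eq
      where
      head : ∀ {s} → Satisfies (c ∷ cs) s → parity c s ≡ false
      head (x ∷ _) = x
      tail : ∀ {s} → Satisfies (c ∷ cs) s → Satisfies cs s
      tail (_ ∷ xs) = xs

    cut-echelon : ∀ B cs → Echelon B cs → Echelon (cut f B) cs
    cut-echelon B cs I = record
      { satisfies = cut-satisfies B cs (satisfies I) ; pivot-one = pivot ; pivot-zero = others-zero }
      where
      pivot : ∀ q b → cut f B q ≡ just b → b q ≡ true
      pivot q b′ eq with origin f B q b′ eq
      ... | kept b Bb _ refl = pivot-one I q b Bb
      ... | reduced b q* b* Bb Bb* q≢q* _ _ refl _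
        rewrite pivot-one I q b Bb | pivot-zero I q* q b* Bb* (cong is-just Bb) q≢q* = refl
      others-zero : ∀ q q′ b → cut f B q ≡ just b → is-just (cut f B q′) ≡ true → ¬ q′ ≡ q → b q′ ≡ false
      others-zero q q′ b′ eq occ q′≢q with origin f B q b′ eq
      ... | kept b Bb _ refl = pivot-zero I q q′ b Bb (cut-occupied f B q′ occ) q′≢q
      ... | reduced b q* b* Bb Bb* _ _ _ refl fe
        rewrite pivot-zero I q q′ b Bb (cut-occupied f B q′ occ) q′≢q =
          pivot-zero I q* q′ b* Bb* (cut-occupied f B q′ occ) q′≢q*
        where
        q′≢q* : ¬ q′ ≡ q*
        q′≢q* refl with trans (sym occ) (cong is-just (cut-emptied B fe))
        ... | ()

  cut-parity-echelon : ∀ c B cs → Echelon B cs → Echelon (cut (parity c) B) (c ∷ cs)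
  cut-parity-echelon c B cs I = record
    { satisfies  = λ q b e → cut-kernel (parity c) (parity-linear c) B q b e ∷ satisfies R q b e
    ; pivot-one  = pivot-one R
    ; pivot-zero = pivot-zero R }
    where R = cut-echelon (parity c) (parity-linear c) B cs I

module Adversary {M : Set} (m₀ : M) (π : Protocol M) (k : ℕ) (lab : Node k → ℕ) where
  open GF2 k

  module Run (E : C2Edges k) = Execution m₀ π lab E

  hist : C2Edges k → ℕ → Node k → Hist M
  hist E = Run.state E

  tx : C2Edges k → ℕ → Node k → Maybe M
  tx E t u = if Run.informed E u (hist E t u) then transmitted (Run.act E (hist E t) u) else nothing

  signal : C2Edges k → ℕ → Node k → Maybe (ℕ × M)
  signal E t u = Maybe.map (λ m → (lab u , m)) (tx E t u)

  -- Reception of v in a round t ≥ 1, from its neighbour labels, history and surrounding signals.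
  reception : Node k → List ℕ → Hist M → List (ℕ × M) → Maybe (ℕ × M)
  reception v ns h L = if isReceive (π (lab v) ns h) then theOnly L else nothing

  reception-silent : ∀ v ns h L → theOnly L ≡ nothing → reception v ns h L ≡ nothing
  reception-silent v ns h L e with isReceive (π (lab v) ns h)
  ... | true  = e
  ... | false = refl

  exactlyOne≡theOnly : ∀ E (xs : List A) → Run.exactlyOne E xs ≡ theOnly xs
  exactlyOne≡theOnly E []           = refl
  exactlyOne≡theOnly E (x ∷ [])     = refl
  exactlyOne≡theOnly E (x ∷ y ∷ xs) = refl

  hist-step : ∀ E t v →
    hist E (suc (suc t)) v ≡
      reception v (map lab (neighbours E v)) (hist E (suc t) v)
                (mapMaybe (signal E (suc t)) (neighbours E v))
      ∷ hist E (suc t) v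
  hist-step E t v = cong (λ z → (if isReceive (Run.act E (hist E (suc t)) v) then z else nothing) ∷ hist E (suc t) v)
                         (exactlyOne≡theOnly E (mapMaybe (signal E (suc t)) (neighbours E v)))

  hist-next : ∀ E₁ E₂ t v →
    reception v (map lab (neighbours E₁ v)) (hist E₁ (suc t) v) (mapMaybe (signal E₁ (suc t)) (neighbours E₁ v)) ≡
    reception v (map lab (neighbours E₂ v)) (hist E₂ (suc t) v) (mapMaybe (signal E₂ (suc t)) (neighbours E₂ v)) →
    hist E₁ (suc t) v ≡ hist E₂ (suc t) v → hist E₁ (suc (suc t)) v ≡ hist E₂ (suc (suc t)) v
  hist-next E₁ E₂ t v r h = trans (hist-step E₁ t v) (trans (cong₂ _∷_ r h) (sym (hist-step E₂ t v)))

  l1Nodes : List (Node k)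
  l1Nodes = concatMap (λ g → map (l1 g) (allFin k)) (allFin k)

  l1∈l1Nodes : ∀ g i → Any (l1 g i ≡_) l1Nodes
  l1∈l1Nodes g i = ∈-concatMap⁺ (λ g → map (l1 g) (allFin k))
    (Data.List.Relation.Unary.Any.map (λ { refl → ∈-map⁺ (l1 g) (∈-allFin i) }) (∈-allFin g))

  l1-neighbours : Fin k → Bool → List (Node k)
  l1-neighbours g b = src ∷ (if b then l2 g ∷ [] else [])

  l1-tx : Fin k → Fin k → Bool → Hist M → Maybe M
  l1-tx g i b h = if any is-just h then transmitted (π (lab (l1 g i)) (map lab (l1-neighbours g b)) h) else nothing

  l1-tx-local : ∀ E t g i → tx E t (l1 g i) ≡ l1-tx g i (E g i) (hist E t (l1 g i))
  l1-tx-local E t g i = refl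

  l2-tx : Fin k → List (Fin k) → Hist M → Maybe M
  l2-tx g is h = if any is-just h then transmitted (π (lab (l2 g)) (map lab (map (l1 g) is)) h) else nothing

  l2-tx-local : ∀ E t g → tx E t (l2 g) ≡ l2-tx g (filterᵇ (E g) (allFin k)) (hist E t (l2 g))
  l2-tx-local E t g = refl

  silence : ∀ n → any is-just (replicate {A = Maybe (ℕ × M)} n nothing) ≡ false
  silence zero    = refl
  silence (suc n) = silence n

  -- An L2 node that has heard nothing is uninformed, hence silent.
  uninformed-silent : ∀ E t g → hist E t (l2 g) ≡ replicate t nothing → tx E t (l2 g) ≡ nothing
  uninformed-silent E t g e rewrite e | silence t = refl

  hist-1-l1 : ∀ E g i → hist E 1 (l1 g i) ≡ just (lab src , m₀) ∷ []
  hist-1-l1 E g i with E g i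
  ... | false = refl
  ... | true  = refl

  hist-1-l2 : ∀ E g → hist E 1 (l2 g) ≡ nothing ∷ []
  hist-1-l2 E g = cong (_∷ []) (trans (cong (Run.exactlyOne E) (nobody (filterᵇ (E g) (allFin k))))
                                      (exactlyOne≡theOnly E []))
    where
    nobody : ∀ is → mapMaybe (λ u → Maybe.map (λ m → (lab u , m)) (if isSrc u then just m₀ else nothing))
                             (map (l1 g) is) ≡ []
    nobody []       = refl
    nobody (_ ∷ is) = nobody is

  -- The adversary's knowledge about one group: its row is settled, or it is
  -- any admissible row of a live echelon basis with parity constraints.
  data GroupState : Set where
    settled : Row → GroupState
    live    : Basis → List Row → GroupState

  isSettled : GroupState → Bool
  isSettled (settled _) = true
  isSettled (live _ _)  = false

  _∋_ : GroupState → Row → Set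
  settled S ∋ s = ∀ j → s j ≡ S j
  live B cs ∋ s = Admissible B cs s

  -- Settled rows are nonzero (l2 g has a neighbour); live bases are echelon.
  WellFormed : GroupState → Set
  WellFormed (settled S) = ∃ λ j → S j ≡ true
  WellFormed (live B cs) = Echelon B cs

  RankAtLeast : ℕ → GroupState → Set
  RankAtLeast d (settled _) = ⊤
  RankAtLeast d (live B _)  = d ≤ rank B

  rank-weaken : ∀ d x → RankAtLeast (suc d) x → RankAtLeast d x
  rank-weaken d (settled _) _ = tt
  rank-weaken d (live _ _)  h = m+n≤o⇒n≤o 1 h

  Family : Set
  Family = Fin k → GroupState

  _∈F_ : C2Edges k → Family → Set
  E ∈F F = ∀ g → F g ∋ E g

  WF : Family → Set
  WF F = ∀ g → WellFormed (F g)

  settledCount : Family → ℕ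
  settledCount F = count (isSettled ∘ F)

  record Agree (t : ℕ) (F : Family) (E₁ E₂ : C2Edges k) : Set where
    field
      agree-src : hist E₁ t src ≡ hist E₂ t src
      agree-l1  : ∀ g i → E₁ g i ≡ E₂ g i → hist E₁ t (l1 g i) ≡ hist E₂ t (l1 g i)
      agree-l2  : ∀ g → isSettled (F g) ≡ true → hist E₁ t (l2 g) ≡ hist E₂ t (l2 g)
  open Agree public

  Quiet : ℕ → Family → C2Edges k → Set
  Quiet t F E = ∀ g → isSettled (F g) ≡ false → hist E t (l2 g) ≡ replicate t nothing

  record Good (t : ℕ) (F : Family) : Set where
    field
      agree : ∀ E₁ E₂ → E₁ ∈F F → E₂ ∈F F → Agree t F E₁ E₂
      quiet : ∀ E → E ∈F F → Quiet t F E
  open Good public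

  -- Every family is good at times 0 and 1: round 0 does not depend on the network.
  good-0 : ∀ F → Good 0 F
  good-0 F = record
    { agree = λ _ _ _ _ → record { agree-src = refl ; agree-l1 = λ _ _ _ → refl ; agree-l2 = λ _ _ → refl }
    ; quiet = λ _ _ _ _ → refl }

  good-1 : ∀ F → Good 1 F
  good-1 F = record
    { agree = λ E₁ E₂ _ _ → record
        { agree-src = refl
        ; agree-l1  = λ g i _ → trans (hist-1-l1 E₁ g i) (sym (hist-1-l1 E₂ g i))
        ; agree-l2  = λ g _ → trans (hist-1-l2 E₁ g) (sym (hist-1-l2 E₂ g)) }
    ; quiet = λ E _ g _ → hist-1-l2 E g }

  baseRow : GroupState → Row
  baseRow (settled S) = S
  baseRow (live _ _)  = zeroRow

  witnessRow : GroupState → Fin k → Bool → Row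
  witnessRow (live B cs) i true = Maybe.fromMaybe zeroRow (pivotFor B i)
  witnessRow x           i _    = baseRow x

  baseRow-∋ : ∀ x → WellFormed x → x ∋ baseRow x
  baseRow-∋ (settled S) _ j = refl
  baseRow-∋ (live B cs) _   = satisfies-zero cs , λ _ _ → refl

  witnessRow-∋ : ∀ x i b → WellFormed x → x ∋ witnessRow x i b
  witnessRow-∋ (settled S) i b     w = baseRow-∋ (settled S) w
  witnessRow-∋ (live B cs) i false w = baseRow-∋ (live B cs) w
  witnessRow-∋ (live B cs) i true  w with pivotFor B i in e
  ... | nothing = baseRow-∋ (live B cs) w
  ... | just v with pivotFor-just B i e
  ...   | q , Bq , _ = satisfies w q v Bq , λ j z → z q v Bq

  witnessRow-bit : ∀ x i s → x ∋ s → witnessRow x i (s i) i ≡ s i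
  witnessRow-bit (settled S) i s m = sym (m i)
  witnessRow-bit (live B cs) i s (_ , van) with s i in si
  ... | false = refl
  ... | true with pivotFor B i in e
  ...   | just v  = proj₂ (proj₂ (pivotFor-just B i e))
  ...   | nothing with trans (sym si) (van i (pivotFor-nothing B i e))
  ...     | ()

  witness : Family → Fin k → Fin k → Bool → C2Edges k
  witness F g i b = updateAt (baseRow ∘ F) g (const (witnessRow (F g) i b))

  witness-∈ : ∀ F → WF F → ∀ g i b → witness F g i b ∈F F
  witness-∈ F w g i b = updateAt-lift (λ g′ s → F g′ ∋ s) (baseRow ∘ F) g _
                          (witnessRow-∋ (F g) i b (w g)) (λ g′ _ → baseRow-∋ (F g′) (w g′))

  witness-bit : ∀ F E → E ∈F F → ∀ g i → witness F g i (E g i) g i ≡ E g i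
  witness-bit F E m g i = trans (cong (λ s → s i) (updateAt-updates g (baseRow ∘ F)))
                                (witnessRow-bit (F g) i (E g) (m g))

  -- The transmission table of round t: what l1 g i sends with edge bit b.
  Table : Set
  Table = Fin k → Fin k → Bool → Maybe M

  table : Family → ℕ → Table
  table F t g i b = tx (witness F g i b) t (l1 g i)

  tx-by-table : ∀ t F → WF F → Good t F → ∀ E → E ∈F F → ∀ g i → tx E t (l1 g i) ≡ table F t g i (E g i)
  tx-by-table t F w G E m g i = begin
      tx E t (l1 g i)                                       ≡⟨ l1-tx-local E t g i ⟩
      l1-tx g i (E g i) (hist E t (l1 g i))                 ≡⟨ cong₂ (l1-tx g i) (sym bit≡) (sym same-hist) ⟩
      l1-tx g i (W g i) (hist W t (l1 g i))                 ≡⟨ sym (l1-tx-local W t g i) ⟩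
      tx W t (l1 g i)                                       ∎
    where
    open ≡-Reasoning
    W = witness F g i (E g i)
    bit≡ = witness-bit F E m g i
    same-hist : hist W t (l1 g i) ≡ hist E t (l1 g i)
    same-hist = agree-l1 (agree G W E (witness-∈ F w g i (E g i)) m) g i bit≡

  transmits : Table → Fin k → Fin k → Bool → Bool
  transmits T g i b = is-just (T g i b)

  -- Parity phase: a live L2 node hears nothing if an even number of its
  -- neighbours transmit, i.e. its row s satisfies parity (txRow T g) s = 0.
  txRow : Table → Fin k → Row
  txRow T g i = transmits T g i true

  parityCut : Row → GroupState → GroupState
  parityCut c (settled S) = settled S
  parityCut c (live B cs) = live (cut (parity c) B) (c ∷ cs)

  parityCut-∋ : ∀ c x s → parityCut c x ∋ s → x ∋ s
  parityCut-∋ c (settled S) s m = m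
  parityCut-∋ c (live B cs) s (_ ∷ sat , van) =
    sat , λ j z → van j (cut-vanishes (parity c) B j z)

  parityCut-even : ∀ c x s → isSettled (parityCut c x) ≡ false → parityCut c x ∋ s → parity c s ≡ false
  parityCut-even c (live B cs) s _ (even ∷ _ , _) = even

  parityCut-settled : ∀ c x → isSettled (parityCut c x) ≡ isSettled x
  parityCut-settled c (settled S) = refl
  parityCut-settled c (live B cs) = refl

  parityCut-wf : ∀ c x → WellFormed x → WellFormed (parityCut c x)
  parityCut-wf c (settled S) w = w
  parityCut-wf c (live B cs) w = cut-parity-echelon c B cs w

  parityCut-rank : ∀ c x d → RankAtLeast (suc d) x → RankAtLeast d (parityCut c x)
  parityCut-rank c (settled S) d _ = tt
  parityCut-rank c (live B cs) d h = ≤-pred (≤-trans h (rank-cut (parity c) B))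

  parityPhase : Table → Family → Family
  parityPhase T F g = parityCut (txRow T g) (F g)

  -- Forcing phase for a fixed table T: make the source's reception independent of the network.
  module Forcing (T : Table) where

    -- l1 g i transmits in every network of the group state.
    sure : Fin k → Fin k → GroupState → Bool
    sure g i (settled S) = transmits T g i (S i)
    sure g i (live B cs) = not (is-just (pivotFor B i)) ∧ transmits T g i false

    -- The edge bit of l1 g i is still free and for some value of it l1 g i transmits.
    unsure : Fin k → Fin k → GroupState → Bool
    unsure g i (settled _) = false
    unsure g i (live B cs) = is-just (pivotFor B i) ∧ (transmits T g i false ∨ transmits T g i true)

    sureAt : Family → Node k → Bool
    sureAt F (l1 g i) = sure g i (F g)
    sureAt F src      = false
    sureAt F (l2 _)   = false

    sureCount : Family → ℕ
    sureCount F = length (filterᵇ (sureAt F) l1Nodes)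

    firstUnsure : Family → Maybe (Fin k × Fin k)
    firstUnsure F = firstJust λ g → firstJust λ i → if unsure g i (F g) then just (g , i) else nothing

    -- Turn l1 g i into a sure transmitter: if it transmits without its edge,
    -- forbid the edge (cut by the i-th coordinate); otherwise settle the group
    -- on a basis row containing the edge.
    settleOn : Basis → List Row → Maybe Row → GroupState
    settleOn B cs (just v) = settled v
    settleOn B cs nothing  = live B cs

    forceGroup : Fin k → Fin k → GroupState → GroupState
    forceGroup g i (settled S) = settled S
    forceGroup g i (live B cs) =
      if transmits T g i false then live (cut (λ s → s i) B) cs else settleOn B cs (pivotFor B i)

    forceAt : Family → Fin k → Fin k → Family
    forceAt F g i = updateAt F g (forceGroup g i)

    forceOn : Family → Maybe (Fin k × Fin k) → Family
    forceOn F nothing        = F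
    forceOn F (just (g , i)) = forceAt F g i

    forceIf : ∀ F → Dec (2 ≤ sureCount F) → Family
    forceIf F (yes _) = F
    forceIf F (no  _) = forceOn F (firstUnsure F)

    forceStep : Family → Family
    forceStep F = forceIf F (2 ≤? sureCount F)

    forceGroup-∋ : ∀ g i x → WellFormed x → ∀ s → forceGroup g i x ∋ s → x ∋ s
    forceGroup-∋ g i (settled S) w s m = m
    forceGroup-∋ g i (live B cs) w s m with transmits T g i false | m
    ... | true  | sat , van = sat , λ j z → van j (cut-vanishes (λ s → s i) B j z)
    ... | false | m′ with pivotFor B i in e | m′
    ...   | nothing | m″ = m″
    ...   | just v  | m″ with pivotFor-just B i e
    ...     | q , Bq , _ = satisfies-ext cs s v m″ (satisfies w q v Bq) , λ j z → trans (m″ j) (z q v Bq)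

    forceGroup-wf : ∀ g i x → WellFormed x → WellFormed (forceGroup g i x)
    forceGroup-wf g i (settled S) w = w
    forceGroup-wf g i (live B cs) w with transmits T g i false
    ... | true  = cut-echelon (λ s → s i) (coordinate-linear i) B cs w
    ... | false with pivotFor B i in e
    ...   | nothing = w
    ...   | just v  = i , proj₂ (proj₂ (pivotFor-just B i e))

    forceGroup-settled : ∀ g i x → isSettled x ≡ true → isSettled (forceGroup g i x) ≡ true
    forceGroup-settled g i (settled S) _ = refl

    forceGroup-rank : ∀ g i x d → RankAtLeast (suc d) x → RankAtLeast d (forceGroup g i x)
    forceGroup-rank g i (settled S) d _ = tt
    forceGroup-rank g i (live B cs) d h with transmits T g i false
    ... | true  = ≤-pred (≤-trans h (rank-cut (λ s → s i) B))
    ... | false with pivotFor B i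
    ...   | nothing = rank-weaken d (live B cs) h
    ...   | just _  = tt

    sure-live : ∀ g j B cs → pivotFor B j ≡ nothing → transmits T g j false ≡ true → sure g j (live B cs) ≡ true
    sure-live g j B cs p t rewrite p | t = refl

    sure-live⁻¹ : ∀ g j B cs → sure g j (live B cs) ≡ true → pivotFor B j ≡ nothing × transmits T g j false ≡ true
    sure-live⁻¹ g j B cs e with pivotFor B j | e
    ... | nothing | t = refl , t

    sure-transmits : ∀ g i x s → x ∋ s → sure g i x ≡ true → transmits T g i (s i) ≡ true
    sure-transmits g i (settled S) s m e rewrite m i = e
    sure-transmits g i (live B cs) s (_ , van) e with sure-live⁻¹ g i B cs e
    ... | p , t₀ rewrite van i (pivotFor-nothing B i p) = t₀

    steady : ∀ g i x s₁ s₂ → x ∋ s₁ → x ∋ s₂ → unsure g i x ≡ false → T g i (s₁ i) ≡ T g i (s₂ i)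
    steady g i (settled S) s₁ s₂ m₁ m₂ _ rewrite m₁ i | m₂ i = refl
    steady g i (live B cs) s₁ s₂ (_ , van₁) (_ , van₂) u with pivotFor B i in e
    ... | nothing rewrite van₁ i (pivotFor-nothing B i e) | van₂ i (pivotFor-nothing B i e) = refl
    ... | just _ = trans (silent (s₁ i)) (sym (silent (s₂ i)))
      where
      silent : ∀ b → T g i b ≡ nothing
      silent false with T g i false | ∨-conicalˡ (transmits T g i false) (transmits T g i true) u
      ... | nothing | _ = refl
      silent true with T g i true | ∨-conicalʳ (transmits T g i false) (transmits T g i true) u
      ... | nothing | _ = refl

    forceGroup-sure : ∀ g i x → unsure g i x ≡ true →
      (∀ j → sure g j x ≡ true → sure g j (forceGroup g i x) ≡ true) × sure g i (forceGroup g i x) ≡ true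
    forceGroup-sure g i (live B cs) u
      with transmits T g i false in t₀ | transmits T g i true in t₁ | ∧-conicalʳ (is-just (pivotFor B i)) _ u
    ... | false | false | ()
    ... | true  | _     | _ = stays-sure , becomes-sure
      where
      B′ = cut (λ s → s i) B
      -- coordinates where B vanishes, and coordinate i itself, carry no pivot after the cut
      stays-sure : ∀ j → sure g j (live B cs) ≡ true → sure g j (live B′ cs) ≡ true
      stays-sure j e with sure-live⁻¹ g j B cs e
      ... | p , t = sure-live g j B′ cs (vanishes⇒pivotFor-nothing B′ j (cut-vanishes (λ s → s i) B j (pivotFor-nothing B j p))) t
      becomes-sure : sure g i (live B′ cs) ≡ true
      becomes-sure = sure-live g i B′ cs (vanishes⇒pivotFor-nothing B′ i (cut-kernel (λ s → s i) (coordinate-linear i) B)) t₀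
    ... | false | true | _ with pivotFor B i in e | ∧-conicalˡ _ (transmits T g i false ∨ transmits T g i true) u
    ...   | nothing | ()
    ...   | just v  | _ with pivotFor-just B i e
    ...     | q , Bq , vi = stays-sure , trans (cong (transmits T g i) vi) t₁
      where
      stays-sure : ∀ j → sure g j (live B cs) ≡ true → transmits T g j (v j) ≡ true
      stays-sure j s with sure-live⁻¹ g j B cs s
      ... | p , t rewrite pivotFor-nothing B j p q v Bq = t

    unsure⇒¬sure : ∀ g i x → unsure g i x ≡ true → sure g i x ≡ false
    unsure⇒¬sure g i (live B cs) u with is-just (pivotFor B i) | u
    ... | true | _ = refl

    sureCount-forceAt : ∀ F g i → unsure g i (F g) ≡ true → sureCount F < sureCount (forceAt F g i)
    sureCount-forceAt F g i u =
      filter-mono-< (sureAt F) (sureAt (forceAt F g i)) stays-sure l1Nodes (l1∈l1Nodes g i) becomes-sure (unsure⇒¬sure g i (F g) u)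
      where
      forced : forceAt F g i g ≡ forceGroup g i (F g)
      forced = updateAt-updates g F
      stays-sure : ∀ u → sureAt F u ≡ true → sureAt (forceAt F g i) u ≡ true
      stays-sure (l1 g′ j) e with g′ ≟ g
      ... | yes refl = subst (λ x → sure g j x ≡ true) (sym forced) (proj₁ (forceGroup-sure g i (F g) u) j e)
      ... | no g′≢g  = subst (λ x → sure g′ j x ≡ true) (sym (updateAt-minimal g′ g F g′≢g)) e
      becomes-sure : sureAt (forceAt F g i) (l1 g i) ≡ true
      becomes-sure = subst (λ x → sure g i x ≡ true) (sym forced) (proj₂ (forceGroup-sure g i (F g) u))

    firstUnsure-just : ∀ F {g i} → firstUnsure F ≡ just (g , i) → unsure g i (F g) ≡ true
    firstUnsure-just F e with firstJust-sound _ e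
    ... | g′ , e′ with firstJust-sound _ e′
    ...   | i′ , e″ with unsure g′ i′ (F g′) in u | e″
    ...     | true | refl = u

    firstUnsure-nothing : ∀ F → firstUnsure F ≡ nothing → ∀ g i → unsure g i (F g) ≡ false
    firstUnsure-nothing F e g i with firstJust-nothing _ (firstJust-nothing _ e g) i
    ... | e′ with unsure g i (F g)
    ...   | false = refl

    data ForceCase (F : Family) : Family → Set where
      collision : 2 ≤ sureCount F → ForceCase F F
      stable    : firstUnsure F ≡ nothing → ForceCase F F
      forced    : ∀ g i → unsure g i (F g) ≡ true → ForceCase F (forceAt F g i)

    forceCase : ∀ F → ForceCase F (forceStep F)
    forceCase F = decide (2 ≤? sureCount F)
      where
      decide : ∀ d → ForceCase F (forceIf F d)
      decide (yes p) = collision p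
      decide (no _) with firstUnsure F in e
      ... | nothing      = stable e
      ... | just (g , i) = forced g i (firstUnsure-just F e)

    forceStep-lift : ∀ (P : Family → Set) F → P F → (∀ g i → P (forceAt F g i)) → P (forceStep F)
    forceStep-lift P F p h with forceStep F | forceCase F
    ... | _ | collision _  = p
    ... | _ | stable _     = p
    ... | _ | forced g i _ = h g i

    forceStep-∋ : ∀ F → WF F → ∀ E → E ∈F forceStep F → E ∈F F
    forceStep-∋ F w E = forceStep-lift (λ F′ → E ∈F F′ → E ∈F F) F (λ m → m) at
      where
      at : ∀ g i → E ∈F forceAt F g i → E ∈F F
      at g i m g′ with g′ ≟ g
      ... | yes refl = forceGroup-∋ g i (F g) (w g) (E g) (subst (_∋ E g) (updateAt-updates g F) (m g))
      ... | no g′≢g  = subst (_∋ E g′) (updateAt-minimal g′ g F g′≢g) (m g′)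

    forceStep-wf : ∀ F → WF F → WF (forceStep F)
    forceStep-wf F w = forceStep-lift WF F w λ g i →
      updateAt-lift (λ _ → WellFormed) F g _ (forceGroup-wf g i (F g) (w g)) (λ g′ _ → w g′)

    forceStep-settled : ∀ F g → isSettled (F g) ≡ true → isSettled (forceStep F g) ≡ true
    forceStep-settled F g e = forceStep-lift (λ F′ → isSettled (F′ g) ≡ true) F e λ g′ i →
      updateAt-lift (λ g″ x → isSettled (F g″) ≡ true → isSettled x ≡ true) F g′ _
        (forceGroup-settled g′ i (F g′)) (λ _ _ e′ → e′) g e

    forceStep-rank : ∀ F d → (∀ g → RankAtLeast (suc d) (F g)) → ∀ g → RankAtLeast d (forceStep F g)
    forceStep-rank F d h = forceStep-lift (λ F′ → ∀ g → RankAtLeast d (F′ g)) F (λ g → rank-weaken d (F g) (h g)) λ g i →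
      updateAt-lift (λ _ → RankAtLeast d) F g _ (forceGroup-rank g i (F g) d (h g)) (λ g′ _ → rank-weaken d (F g′) (h g′))

    forceStep-settledCount : ∀ F → settledCount (forceStep F) ≤ suc (settledCount F)
    forceStep-settledCount F = forceStep-lift (λ F′ → settledCount F′ ≤ suc (settledCount F)) F (n≤1+n _) λ g i →
      count-except _ _ g (newly-settled g i)
      where
      newly-settled : ∀ g i g′ → isSettled (forceAt F g i g′) ≡ true → isSettled (F g′) ≡ true ⊎ g′ ≡ g
      newly-settled g i g′ e with g′ ≟ g
      ... | yes g′≡g = inj₂ g′≡g
      ... | no g′≢g  = inj₁ (trans (cong isSettled (sym (updateAt-minimal g′ g F g′≢g))) e)

    SourceFixed : Family → Set
    SourceFixed F = 2 ≤ sureCount F ⊎ (∀ g i → unsure g i (F g) ≡ false)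

    forceTwice-fixes : ∀ F → SourceFixed (forceStep (forceStep F))
    forceTwice-fixes F with forceStep F | forceCase F
    ... | F₁ | c₁ with forceStep F₁ | forceCase F₁
    ...   | _ | collision p  = inj₁ p
    ...   | _ | stable e     = inj₂ (firstUnsure-nothing F₁ e)
    ...   | _ | forced g i u = inj₁ (≤-trans (s≤s (one-sure c₁)) (sureCount-forceAt F₁ g i u))
      where
      -- the first step already produced a sure transmitter, since F₁ has an unsure node
      one-sure : ForceCase F F₁ → 1 ≤ sureCount F₁
      one-sure (collision p)     = ≤-trans (s≤s z≤n) p
      one-sure (forced g′ i′ u′) = ≤-trans (s≤s z≤n) (sureCount-forceAt F g′ i′ u′)
      one-sure (stable e) with trans (sym (firstUnsure-nothing F e g i)) u
      ... | ()

  nextFamily : ℕ → Family → Family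
  nextFamily t F = forceStep (forceStep (parityPhase (table F t) F))
    where open Forcing (table F t)

  module NextFamily (t : ℕ) (F : Family) (w : WF F) where
    open Forcing (table F t) public

    private
      T  = table F t
      F₀ = parityPhase T F
      F₁ = forceStep F₀

      w₀ : WF F₀
      w₀ g = parityCut-wf (txRow T g) (F g) (w g)

      ∋₀ : ∀ E → E ∈F F₀ → E ∈F F
      ∋₀ E m g = parityCut-∋ (txRow T g) (F g) (E g) (m g)

      ∋₁ : ∀ E → E ∈F nextFamily t F → E ∈F F₀
      ∋₁ E m = forceStep-∋ F₀ w₀ E (forceStep-∋ F₁ (forceStep-wf F₀ w₀) E m)

    next-∋ : ∀ E → E ∈F nextFamily t F → E ∈F F
    next-∋ E m = ∋₀ E (∋₁ E m)

    next-wf : WF (nextFamily t F)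
    next-wf = forceStep-wf F₁ (forceStep-wf F₀ w₀)

    next-settled : ∀ g → isSettled (F g) ≡ true → isSettled (nextFamily t F g) ≡ true
    next-settled g e = forceStep-settled F₁ g (forceStep-settled F₀ g (trans (parityCut-settled (txRow T g) (F g)) e))

    next-live : ∀ g → isSettled (nextFamily t F g) ≡ false → isSettled (F g) ≡ false
    next-live g e with isSettled (F g) in s
    ... | false = refl
    ... | true with trans (sym (next-settled g s)) e
    ...   | ()

    next-rank : ∀ d → (∀ g → RankAtLeast (3 + d) (F g)) → ∀ g → RankAtLeast d (nextFamily t F g)
    next-rank d h = forceStep-rank F₁ d (forceStep-rank F₀ (suc d) λ g → parityCut-rank (txRow T g) (F g) (2 + d) (h g))

    next-settledCount : settledCount (nextFamily t F) ≤ 2 + settledCount F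
    next-settledCount =
      ≤-trans (forceStep-settledCount F₁) (s≤s (≤-trans (forceStep-settledCount F₀) (s≤s (≤-reflexive same))))
      where
      same : settledCount F₀ ≡ settledCount F
      same = count-cong _ _ λ g → parityCut-settled (txRow T g) (F g)

    next-even : ∀ E → E ∈F nextFamily t F → ∀ g → isSettled (nextFamily t F g) ≡ false →
                parity (txRow T g) (E g) ≡ false
    next-even E m g e =
      parityCut-even (txRow T g) (F g) (E g) (trans (parityCut-settled (txRow T g) (F g)) (next-live g e)) (∋₁ E m g)

    next-source : SourceFixed (nextFamily t F)
    next-source = forceTwice-fixes F₀

  settled-rows : ∀ x s₁ s₂ → isSettled x ≡ true → x ∋ s₁ → x ∋ s₂ → ∀ j → s₁ j ≡ s₂ j
  settled-rows (settled S) s₁ s₂ _ m₁ m₂ j = trans (m₁ j) (sym (m₂ j))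

  module RoundStep (t : ℕ) (F : Family) (w : WF F) (G : Good (suc t) F) where
    private
      τ  = suc t
      T  = table F τ
      F′ = nextFamily τ F
    open NextFamily τ F w

    module _ (E₁ E₂ : C2Edges k) (m₁′ : E₁ ∈F F′) (m₂′ : E₂ ∈F F′) where
      private
        m₁ = next-∋ E₁ m₁′
        m₂ = next-∋ E₂ m₂′
        Ag = agree G E₁ E₂ m₁ m₂

      tx-l1 : ∀ g i → E₁ g i ≡ E₂ g i → tx E₁ τ (l1 g i) ≡ tx E₂ τ (l1 g i)
      tx-l1 g i eb = trans (tx-by-table τ F w G E₁ m₁ g i)
                    (trans (cong (T g i) eb) (sym (tx-by-table τ F w G E₂ m₂ g i)))

      tx-src : tx E₁ τ src ≡ tx E₂ τ src
      tx-src = cong (λ h → transmitted (π (lab src) (map lab l1Nodes) h)) (agree-src Ag)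

      -- A live L2 node is still silent; a settled one has the same neighbours and history.
      tx-l2 : ∀ g → tx E₁ τ (l2 g) ≡ tx E₂ τ (l2 g)
      tx-l2 g with isSettled (F g) in s
      ... | false = trans (uninformed-silent E₁ τ g (quiet G E₁ m₁ g s))
                          (sym (uninformed-silent E₂ τ g (quiet G E₂ m₂ g s)))
      ... | true  = begin
        tx E₁ τ (l2 g)                                              ≡⟨ l2-tx-local E₁ τ g ⟩
        l2-tx g (filterᵇ (E₁ g) (allFin k)) (hist E₁ τ (l2 g))      ≡⟨ cong₂ (l2-tx g) same-neighbours (agree-l2 Ag g s) ⟩
        l2-tx g (filterᵇ (E₂ g) (allFin k)) (hist E₂ τ (l2 g))      ≡⟨ sym (l2-tx-local E₂ τ g) ⟩
        tx E₂ τ (l2 g)                                              ∎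
        where
        open ≡-Reasoning
        same-neighbours = filter-cong (E₁ g) (E₂ g) (settled-rows (F g) (E₁ g) (E₂ g) s (m₁ g) (m₂ g)) (allFin k)

      signal-src : signal E₁ τ src ≡ signal E₂ τ src
      signal-src = cong (Maybe.map _) tx-src

      signal-l2 : ∀ g → signal E₁ τ (l2 g) ≡ signal E₂ τ (l2 g)
      signal-l2 g = cong (Maybe.map _) (tx-l2 g)

      source-collision : ∀ E → E ∈F F′ → 2 ≤ sureCount F′ → theOnly (mapMaybe (signal E τ) l1Nodes) ≡ nothing
      source-collision E m′ p = theOnly-≥2 _ (≤-trans p (filter≤mapMaybe (sureAt F′) (signal E τ) sure-signal l1Nodes))
        where
        sure-signal : ∀ u → sureAt F′ u ≡ true → is-just (signal E τ u) ≡ true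
        sure-signal (l1 g i) e = trans (is-just-map _ (tx E τ (l1 g i)))
          (trans (cong is-just (tx-by-table τ F w G E (next-∋ E m′) g i)) (sure-transmits g i (F′ g) (E g) (m′ g) e))

      source-hears : SourceFixed F′ →
        reception src (map lab l1Nodes) (hist E₁ τ src) (mapMaybe (signal E₁ τ) l1Nodes) ≡
        reception src (map lab l1Nodes) (hist E₂ τ src) (mapMaybe (signal E₂ τ) l1Nodes)
      source-hears (inj₁ collide) =
        trans (reception-silent src _ (hist E₁ τ src) _ (source-collision E₁ m₁′ collide))
              (sym (reception-silent src _ (hist E₂ τ src) _ (source-collision E₂ m₂′ collide)))
      source-hears (inj₂ none-unsure) =
        cong₂ (reception src (map lab l1Nodes)) (agree-src Ag) (mapMaybe-cong same-signal l1Nodes)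
        where
        same-signal : ∀ u → signal E₁ τ u ≡ signal E₂ τ u
        same-signal src      = signal-src
        same-signal (l2 g)   = signal-l2 g
        same-signal (l1 g i) = cong (Maybe.map _) (trans (tx-by-table τ F w G E₁ m₁ g i)
          (trans (steady g i (F′ g) (E₁ g) (E₂ g) (m₁′ g) (m₂′ g) (none-unsure g i))
                 (sym (tx-by-table τ F w G E₂ m₂ g i))))

      agree-src′ : hist E₁ (suc τ) src ≡ hist E₂ (suc τ) src
      agree-src′ = hist-next E₁ E₂ t src (source-hears next-source) (agree-src Ag)

      agree-l1′ : ∀ g i → E₁ g i ≡ E₂ g i → hist E₁ (suc τ) (l1 g i) ≡ hist E₂ (suc τ) (l1 g i)
      agree-l1′ g i eb = hist-next E₁ E₂ t (l1 g i) (trans (heard (E₁ g i)) (cong heard₂ eb)) (agree-l1 Ag g i eb)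
        where
        heard₂ : Bool → Maybe (ℕ × M)
        heard₂ b = reception (l1 g i) (map lab (l1-neighbours g b)) (hist E₂ τ (l1 g i))
                             (mapMaybe (signal E₂ τ) (l1-neighbours g b))
        same-signals : ∀ b → mapMaybe (signal E₁ τ) (l1-neighbours g b) ≡ mapMaybe (signal E₂ τ) (l1-neighbours g b)
        same-signals false rewrite signal-src = refl
        same-signals true  rewrite signal-src | signal-l2 g = refl
        heard : ∀ b → reception (l1 g i) (map lab (l1-neighbours g b)) (hist E₁ τ (l1 g i))
                                (mapMaybe (signal E₁ τ) (l1-neighbours g b)) ≡ heard₂ b
        heard b = cong₂ (reception (l1 g i) (map lab (l1-neighbours g b))) (agree-l1 Ag g i eb) (same-signals b)

      agree-l2′ : ∀ g → isSettled (F′ g) ≡ true → hist E₁ (suc τ) (l2 g) ≡ hist E₂ (suc τ) (l2 g)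
      agree-l2′ g s = hist-next E₁ E₂ t (l2 g) (trans (cong (λ is → heard is (hist E₁ τ (l2 g)) (signals E₁ is)) same-neighbours)
                                                     (cong₂ (heard xs₂) same-hist same-signals))
                                             same-hist
        where
        xs₂ = filterᵇ (E₂ g) (allFin k)
        signals : C2Edges k → List (Fin k) → List (ℕ × M)
        signals E is = mapMaybe (signal E τ) (map (l1 g) is)
        heard : List (Fin k) → Hist M → List (ℕ × M) → Maybe (ℕ × M)
        heard is = reception (l2 g) (map lab (map (l1 g) is))
        same-row : ∀ j → E₁ g j ≡ E₂ g j
        same-row = settled-rows (F′ g) (E₁ g) (E₂ g) s (m₁′ g) (m₂′ g)
        same-neighbours : filterᵇ (E₁ g) (allFin k) ≡ xs₂
        same-neighbours = filter-cong (E₁ g) (E₂ g) same-row (allFin k)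
        same-hist-by : ∀ b → isSettled (F g) ≡ b → hist E₁ τ (l2 g) ≡ hist E₂ τ (l2 g)
        same-hist-by true  s₀ = agree-l2 Ag g s₀
        same-hist-by false s₀ = trans (quiet G E₁ m₁ g s₀) (sym (quiet G E₂ m₂ g s₀))
        same-hist : hist E₁ τ (l2 g) ≡ hist E₂ τ (l2 g)
        same-hist = same-hist-by (isSettled (F g)) refl
        same-signals : signals E₁ xs₂ ≡ signals E₂ xs₂
        same-signals = trans (mapMaybe-map (signal E₁ τ) (l1 g) xs₂)
          (trans (mapMaybe-cong (λ j → cong (Maybe.map _) (tx-l1 g j (same-row j))) xs₂)
                 (sym (mapMaybe-map (signal E₂ τ) (l1 g) xs₂)))

    -- A live L2 node has an even number of transmitting neighbours, so it hears nothing.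
    quiet′ : ∀ E → E ∈F F′ → Quiet (suc τ) F′ E
    quiet′ E m′ g live′ = trans (hist-step E t (l2 g))
      (cong₂ _∷_ (reception-silent _ _ _ _ (theOnly-even _ even)) (quiet G E m g (next-live g live′)))
      where
      m = next-∋ E m′
      records : ∀ j → E g j ≡ true → is-just (signal E τ (l1 g j)) ≡ txRow T g j
      records j e = trans (is-just-map _ (tx E τ (l1 g j)))
                    (cong is-just (trans (tx-by-table τ F w G E m g j) (cong (T g j) e)))
      even : odd (length (mapMaybe (signal E τ) (map (l1 g) (filterᵇ (E g) (allFin k))))) ≡ false
      even = trans (cong (odd ∘ length) (mapMaybe-map (signal E τ) (l1 g) (filterᵇ (E g) (allFin k))))
             (trans (odd-successes (signal E τ ∘ l1 g) (E g) (txRow T g) records (allFin k))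
                    (next-even E m′ g live′))

    good-step : Good (suc τ) F′
    good-step = record
      { agree = λ E₁ E₂ m₁′ m₂′ → record
          { agree-src = agree-src′ E₁ E₂ m₁′ m₂′
          ; agree-l1  = agree-l1′ E₁ E₂ m₁′ m₂′
          ; agree-l2  = agree-l2′ E₁ E₂ m₁′ m₂′ }
      ; quiet = quiet′ }

  -- The adversary's families round by round, starting from the full space
  -- GF(2)^k (the unit basis, no constraints) in every group.
  unitBasis : Basis
  unitBasis q = just (λ j → does (q ≟ j))

  unitBasis-echelon : Echelon unitBasis []
  unitBasis-echelon = record
    { satisfies  = λ { q b refl → [] }
    ; pivot-one  = λ { q b refl → dec-true (q ≟ q) refl }
    ; pivot-zero = λ { q q′ b refl _ q′≢q → dec-false (q ≟ q′) (q′≢q ∘ sym) } }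

  family : ℕ → Family
  family zero    _ = live unitBasis []
  family (suc t)   = nextFamily t (family t)

  family-wf : ∀ t → WF (family t)
  family-wf zero    _ = unitBasis-echelon
  family-wf (suc t)   = NextFamily.next-wf t (family t) (family-wf t)

  family-good : ∀ t → Good t (family t)
  family-good zero          = good-0 (family 0)
  family-good (suc zero)    = good-1 (family 1)
  family-good (suc (suc t)) = RoundStep.good-step t (family (suc t)) (family-wf (suc t)) (family-good (suc t))

  family-rank : ∀ t d → t * 3 + d ≤ k → ∀ g → RankAtLeast d (family t g)
  family-rank zero    d h _ = subst (d ≤_) (sym (count-true k)) h
  family-rank (suc t) d h   = NextFamily.next-rank t (family t) (family-wf t) d
    (family-rank t (3 + d) (subst (_≤ k) (regroup t d) h))
    where
    regroup : ∀ t d → suc t * 3 + d ≡ t * 3 + (3 + d)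
    regroup t d = trans (cong (_+ d) (+-comm 3 (t * 3))) (+-assoc (t * 3) 3 d)

  family-settled : ∀ t → settledCount (family t) ≤ t * 2
  family-settled zero    = ≤-reflexive (count-false k)
  family-settled (suc t) = ≤-trans (NextFamily.next-settledCount t (family t) (family-wf t))
                                   (s≤s (s≤s (family-settled t)))

  finalRow : GroupState → Row
  finalRow (settled S) = S
  finalRow (live B cs) = Maybe.fromMaybe zeroRow (firstJust B)

  finalRow-∋ : ∀ x → WellFormed x → x ∋ finalRow x
  finalRow-∋ (settled S) _ j = refl
  finalRow-∋ (live B cs) w with firstJust B in e
  ... | nothing = satisfies-zero cs , λ _ _ → refl
  ... | just b with firstJust-sound B e
  ...   | q , Bq = satisfies w q b Bq , λ j z → z q b Bq

  finalRow-nonzero : ∀ x → WellFormed x → RankAtLeast 1 x → ∃ λ j → finalRow x j ≡ true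
  finalRow-nonzero (settled S) w _ = w
  finalRow-nonzero (live B cs) w h with count-pos (is-just ∘ B) h
  ... | q₀ , occupied with firstJust B in e
  ...   | just b with firstJust-sound B e
  ...     | q , Bq = q , pivot-one w q b Bq
  finalRow-nonzero (live B cs) w h | q₀ , occupied | nothing
    with trans (sym occupied) (cong is-just (firstJust-nothing B e q₀))
  ... | ()

  -- If 3r + 1 ≤ k, some connected C₂ network is not informed within r rounds:
  -- an unsettled group survives, and its L2 node has heard nothing.
  fooled : ∀ r → r * 3 + 1 ≤ k → ∃ λ (E : C2Edges k) → Connected E × ¬ Completes m₀ π lab E r
  fooled r h = E , connected , incomplete
    where
    E : C2Edges k
    E g = finalRow (family r g)
    E∈ : E ∈F family r
    E∈ g = finalRow-∋ (family r g) (family-wf r g)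
    connected : Connected E
    connected g = finalRow-nonzero (family r g) (family-wf r g) (family-rank r 1 h g)
    few-settled : settledCount (family r) < k
    few-settled = ≤-trans (s≤s (≤-trans (family-settled r) (*-monoʳ-≤ r (s≤s (s≤s z≤n)))))
                          (subst (_≤ k) (+-comm (r * 3) 1) h)
    incomplete : ¬ Completes m₀ π lab E r
    incomplete completes with count-<n (isSettled ∘ family r) few-settled
    ... | g , live-g with trans (sym (completes (l2 g) refl))
                                (trans (cong (any is-just) (quiet (family-good r) E E∈ g live-g)) (silence r))
    ...   | ()

square-reflects-≤ : ∀ a b → a * a ≤ b * b → a ≤ b
square-reflects-≤ a b h with a ≤? b
... | yes a≤b = a≤b
... | no  a≰b = ⊥-elim (<⇒≱ (*-mono-< (≰⇒> a≰b) (≰⇒> a≰b)) h)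

three-plus-one : ∀ R k → 1 ≤ k → 4 * R ≤ k → R * 3 + 1 ≤ k
three-plus-one zero    k 1≤k _ = 1≤k
three-plus-one (suc R) k _   h = begin
    suc R * 3 + 1        ≡⟨ +-comm (suc R * 3) 1 ⟩
    suc (suc R * 3)      ≤⟨ m≤n+m _ R ⟩
    R + suc (suc R * 3)  ≡⟨ regroup ⟩
    4 * suc R            ≤⟨ h ⟩
    k                    ∎
  where
  open ≤-Reasoning
  regroup : R + suc (suc R * 3) ≡ 4 * suc R
  regroup = solve 1 (λ R → R :+ (con 1 :+ (con 1 :+ R) :* con 3) := con 4 :* (con 1 :+ R)) refl R
    where open +-*-Solver

-- Taking c = 4 in the definition of r = o(√n), eventually 4·r(k²) ≤ k, and the adversary applies.
theorem2 : ∀ {M : Set} (m₀ : M) (π : Protocol M) (r : ℕ → ℕ) (lab : Labelling) →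
    ValidLabelling lab → LittleOSqrt r →
    ∃ λ K → ∀ k → K ≤ k →
      ∃ λ (E : C2Edges k) → Connected E × ¬ Completes m₀ π (lab k) E (r (k * k))
theorem2 m₀ π r lab _ r=o√n with r=o√n 4
... | N₀ , eventually = suc N₀ , fooled-from
  where
  fooled-from : ∀ k → suc N₀ ≤ k → ∃ λ (E : C2Edges k) → Connected E × ¬ Completes m₀ π (lab k) E (r (k * k))
  fooled-from k@(suc k′) (s≤s N₀≤k′) =
    Adversary.fooled m₀ π k (lab k) (r (k * k)) (three-plus-one (r (k * k)) k (s≤s z≤n) 4r≤k)
    where
    4r≤k : 4 * r (k * k) ≤ k
    4r≤k = square-reflects-≤ _ k (eventually (k * k) (≤-trans (m≤n⇒m≤1+n N₀≤k′) (m≤m*n k k)))
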